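{- For each positive integer $t$ there is an integer $n_1(t)$ such that every rotation system of size at least $n_1(t)$ has a rotation subsystem of size $t$ that is separated.
   Context: An (abstract) rotation system $\Pi$ on a finite set of integers $\{i_1,\ldots,i_n\}$ with $i_1<\cdots<i_n$ (its ground set; $n$ is its size) is an $n$-tuple $(\Pi(i_1),\ldots,\Pi(i_n))$, where each $\Pi(i_j)$ is a cyclic permutation (cyclic ordering) of $\{i_1,\ldots,i_n\}\setminus\{i_j\}$. For a subset $S$ of the ground set, the rotation subsystem induced by $S$ has ground set $S$ (ordered as integers) and assigns to each $x\in S$ the cyclic order on $S\setminus\{x\}$ obtained from $\Pi(x)$ by deleting the elements not in $S$. $\Pi(i_j)$ is separated if the cyclic permutation $\Pi(i_j)$ can be written as $(\sigma\tau)$, where $\sigma$ is a linear ordering of $\{i_1,\ldots,i_{j-1}\}$ and $\tau$ is a linear ordering of $\{i_{j+1},\ldots,i_n\}$. $\Pi$ is separated if $\Pi(i_j)$ is separated for every $j=1,\ldots,n$. -}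

module Defs where

open import Data.Nat using (ℕ)
open import Data.Fin using (Fin; _<_; _≟_)
open import Data.List using (List; []; _∷_; _++_; take; drop; mapMaybe; filter; allFin)
open import Data.List.Membership.Propositional using (_∈_; _∉_)
open import Data.List.Relation.Unary.All using (All)
open import Data.List.Relation.Unary.Unique.Propositional using (Unique)
open import Data.Maybe using (Maybe; just; nothing)
open import Data.Product using (Σ; _×_; ∃; ∃-syntax)
open import Relation.Binary.PropositionalEquality using (_≡_; _≢_)

-- Ground set {i_1 < ... < i_n} is represented (order-isomorphically) by Fin n.
-- A cyclic permutation of a finite set X is represented by a linear list
-- enumerating X exactly once; the cyclic order is this list read cyclically
-- (two lists represent the same cyclic permutation iff one is a rotation of
-- the other).

IsCyclicOrderWithout : {n : ℕ} → Fin n → List (Fin n) → Set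
IsCyclicOrderWithout {n} i l = (∀ j → j ≢ i → j ∈ l) × (i ∉ l) × Unique l

record RotationSystem (n : ℕ) : Set where
  field
    rot   : Fin n → List (Fin n)
    valid : ∀ i → IsCyclicOrderWithout i (rot i)
open RotationSystem public

rotate : {A : Set} → ℕ → List A → List A
rotate k l = drop k l ++ take k l

preimage : {t n : ℕ} → (Fin t → Fin n) → Fin n → Maybe (Fin t)
preimage {t} f y with filter (λ j → f j ≟ y) (allFin t)
... | []    = nothing
... | j ∷ _ = just j

StrictlyIncreasing : {t n : ℕ} → (Fin t → Fin n) → Set
StrictlyIncreasing f = ∀ a b → a < b → f a < f b

-- Rotation subsystem induced by the subset S = image of a strictly increasing
-- f : Fin t → Fin n, re-indexed order-preservingly by Fin t:
-- Π'(a) = Π(f a) with elements outside S deleted.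
induced : {t n : ℕ} → RotationSystem n → (Fin t → Fin n) → Fin t → List (Fin t)
induced Π f a = mapMaybe (preimage f) (rot Π (f a))

-- Π(i) (given by the representative l) is separated: the cyclic permutation
-- can be written (σ τ) with σ a linear ordering of the elements < i and
-- τ a linear ordering of the elements > i.
SeparatedAt : {n : ℕ} → Fin n → List (Fin n) → Set
SeparatedAt i l = ∃[ k ] ∃[ σ ] ∃[ τ ]
  (rotate k l ≡ σ ++ τ) × All (_< i) σ × All (i <_) τ

Separated : {n : ℕ} → (Fin n → List (Fin n)) → Set
Separated {n} r = ∀ i → SeparatedAt i (r i)

module Submission where

-- The proof is a greedy construction.  We keep a sorted list Ch of chosen
-- elements and a sorted list C of candidates, all larger than Ch, such that
-- for every chosen y the cyclic order Π(y) contains an arc holding every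
-- later chosen element and every candidate but no earlier chosen element.
-- To choose the next element y = min C, cut Π(y) at the elements of Ch:
-- this yields at most |Ch| + 1 runs, and by pigeonhole one run s contains
-- at least a (|Ch| + 1)-th of the remaining candidates.  Keeping only those
-- candidates preserves the invariant, with s as the arc for y.  Starting
-- from all n elements, t steps succeed once n ≥ threshold 0 t.  Finally, an
-- arc of Π(y) avoiding smaller chosen elements and containing the larger
-- ones is exactly a separation of the induced cyclic order at y.

open import Defs
open import Data.Nat using (ℕ; zero; suc; _+_; _*_; _≤_; z≤n; s≤s)
open import Data.Nat.Properties
  using (≤-refl; ≤-trans; ≤-total; n≤1+n; +-mono-≤; +-monoʳ-≤; *-monoʳ-≤; *-monoˡ-≤;
         *-cancelˡ-≤; +-suc; +-comm; +-assoc; +-identityʳ; module ≤-Reasoning)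
open import Data.Nat.ListAction using (sum)
open import Data.Fin using (Fin; _<_; _≟_)
open import Data.Fin.Properties using (<-cmp; <-irrefl; <-asym)
open import Data.List using (List; []; _∷_; _++_; [_]; length; filter; map; take; drop; mapMaybe; allFin; lookup)
open import Data.List.NonEmpty using (List⁺; _∷_; _∷⁺_; head; tail)
open import Data.List.Properties using (length-++; ++-assoc; filter-accept; mapMaybe-++; length-tabulate)
open import Data.List.Membership.Propositional using (_∈_; _∉_)
open import Data.List.Membership.Propositional.Properties
  using (∈-++⁻; ∈-++⁺ˡ; ∈-++⁺ʳ; ∈-∃++; ∈-filter⁻; ∈-lookup)
import Data.List.Membership.DecPropositional as DecMembership
open import Data.List.Relation.Unary.All as All using (All; []; _∷_)
open import Data.List.Relation.Unary.All.Properties using (all-filter) renaming (++⁺ to All-++⁺)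
open import Data.List.Relation.Unary.Any using (Any; here; there)
open import Data.List.Relation.Unary.AllPairs using (AllPairs; []; _∷_)
import Data.List.Relation.Unary.AllPairs as AllPairs
import Data.List.Relation.Unary.AllPairs.Properties as AllPairsₚ
open import Data.List.Relation.Unary.Unique.Propositional using (Unique)
import Data.List.Relation.Unary.Unique.Propositional.Properties as Unique
open import Data.Maybe using (Maybe; just; nothing)
open import Data.Product using (_×_; _,_; ∃; ∃₂; ∃-syntax; proj₁; proj₂)
open import Data.Sum using (_⊎_; inj₁; inj₂)
open import Data.Empty using (⊥-elim)
open import Function using (id; _∘_)
open import Relation.Binary using (DecidableEquality; tri<; tri≈; tri>)
open import Relation.Binary.PropositionalEquality using (_≡_; _≢_; refl; sym; trans; cong; cong₂; subst; module ≡-Reasoning)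
open import Relation.Nullary using (¬_; yes; no)
open import Relation.Unary using (Decidable)

module _ {A : Set} where

  rotate-++ : (P Q : List A) → rotate (length P) (P ++ Q) ≡ Q ++ P
  rotate-++ P Q = cong₂ _++_ (drop-prefix P) (take-prefix P)
    where
    drop-prefix : (P : List A) → drop (length P) (P ++ Q) ≡ Q
    drop-prefix []      = refl
    drop-prefix (_ ∷ P) = drop-prefix P
    take-prefix : (P : List A) → take (length P) (P ++ Q) ≡ P
    take-prefix []      = refl
    take-prefix (x ∷ P) = cong (x ∷_) (take-prefix P)

  unique-middle : (X S Y : List A) → Unique (X ++ S ++ Y) →
                  ∀ {z} → z ∈ S → z ∉ X × z ∉ Y
  unique-middle X S Y u z∈S =
      (λ z∈X → across X u z∈X (∈-++⁺ˡ z∈S) refl)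
    , (λ z∈Y → across S (suffix X u) z∈S z∈Y refl)
    where
    across : ∀ {R : A → A → Set} (X : List A) {Z : List A} →
             AllPairs R (X ++ Z) → ∀ {x z} → x ∈ X → z ∈ Z → R x z
    across (_ ∷ X) (px ∷ _)  (here refl) z∈Z = All.lookup px (∈-++⁺ʳ X z∈Z)
    across (_ ∷ X) (_ ∷ pxs) (there x∈X) z∈Z = across X pxs x∈X z∈Z
    suffix : ∀ {R : A → A → Set} (X : List A) {Z : List A} →
             AllPairs R (X ++ Z) → AllPairs R Z
    suffix []      p       = p
    suffix (_ ∷ X) (_ ∷ p) = suffix X p

  unique-length-≤ : ∀ {xs : List A} (Ch : List A) → Unique xs → All (_∈ Ch) xs →
                    length xs ≤ length Ch
  unique-length-≤ Ch [] [] = z≤n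
  unique-length-≤ {x ∷ xs} Ch (x∉xs ∷ u) (x∈Ch ∷ xs⊆Ch) with ∈-∃++ x∈Ch
  ... | P , Q , refl = begin
    suc (length xs)           ≤⟨ s≤s (unique-length-≤ (P ++ Q) u (All.zipWith remove (x∉xs , xs⊆Ch))) ⟩
    suc (length (P ++ Q))     ≡⟨ cong suc (length-++ P) ⟩
    suc (length P + length Q) ≡⟨ sym (+-suc (length P) (length Q)) ⟩
    length P + length (x ∷ Q) ≡⟨ sym (length-++ P) ⟩
    length (P ++ x ∷ Q)       ∎
    where
    open ≤-Reasoning
    remove : ∀ {w} → x ≢ w × w ∈ P ++ x ∷ Q → w ∈ P ++ Q
    remove (x≢w , w∈) with ∈-++⁻ P w∈
    ... | inj₁ w∈P           = ∈-++⁺ˡ w∈P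
    ... | inj₂ (here refl)   = ⊥-elim (x≢w refl)
    ... | inj₂ (there w∈Q)   = ∈-++⁺ʳ P w∈Q

  mapMaybe-All : {B : Set} (g : A → Maybe B) {Q : B → Set} (xs : List A) →
                 (∀ {z} → z ∈ xs → ∀ j → g z ≡ just j → Q j) → All Q (mapMaybe g xs)
  mapMaybe-All g []       q = []
  mapMaybe-All g (x ∷ xs) q with g x in eq
  ... | just b  = q (here refl) b eq ∷ mapMaybe-All g xs (q ∘ there)
  ... | nothing = mapMaybe-All g xs (q ∘ there)

lookup-mono : ∀ {n} {L : List (Fin n)} → AllPairs _<_ L →
              ∀ {i j} → i < j → lookup L i < lookup L j
lookup-mono {L = _ ∷ L} (px ∷ _) {Fin.zero}  {Fin.suc j} _        = All.lookup px (∈-lookup j)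
lookup-mono {L = _ ∷ L} (_ ∷ p)  {Fin.suc i} {Fin.suc j} (s≤s i<j) = lookup-mono p i<j

preimage-sound : ∀ {t n} (f : Fin t → Fin n) y j → preimage f y ≡ just j → f j ≡ y
preimage-sound {t} f y j eq
  with filter (λ j → f j ≟ y) (allFin t) | all-filter (λ j → f j ≟ y) (allFin t)
preimage-sound f y j refl | _ ∷ _ | fj≡y ∷ _ = fj≡y

module Runs {A : Set} {P : A → Set} (P? : Decidable P) where

  runs : List A → List⁺ (List A)
  runs []       = [] ∷ []
  runs (x ∷ xs) with P? x
  ... | yes _ = [] ∷⁺ runs xs
  ... | no  _ = (x ∷ head (runs xs)) ∷ tail (runs xs)

  RunOf : List A → List A → Set
  RunOf l s = All (¬_ ∘ P) s × ∃₂ λ X Y → l ≡ X ++ s ++ Y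

  shift : ∀ x {xs s} → RunOf xs s → RunOf (x ∷ xs) s
  shift x (free , X , Y , refl) = free , x ∷ X , Y , refl

  first-run-is-prefix : ∀ xs → All (¬_ ∘ P) (head (runs xs)) × ∃ λ R → xs ≡ head (runs xs) ++ R
  first-run-is-prefix []       = [] , [] , refl
  first-run-is-prefix (x ∷ xs) with P? x
  ... | yes _  = [] , x ∷ xs , refl
  ... | no ¬px with first-run-is-prefix xs
  ...   | free , R , xs≡ = (¬px ∷ free) , R , cong (x ∷_) xs≡

  runs-are-runs : ∀ xs → All (RunOf xs) (head (runs xs) ∷ tail (runs xs))
  runs-are-runs []       = ([] , [] , [] , refl) ∷ []
  runs-are-runs (x ∷ xs) with P? x
  ... | yes _  = ([] , [] , x ∷ xs , refl) ∷ All.map (shift x) (runs-are-runs xs)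
  ... | no ¬px with runs-are-runs xs | first-run-is-prefix xs
  ...   | _ ∷ later | free , R , xs≡ =
    ((¬px ∷ free) , [] , R , cong (x ∷_) xs≡) ∷ All.map (shift x) later

  runs-cover : ∀ xs {z} → z ∈ xs → ¬ P z → Any (z ∈_) (head (runs xs) ∷ tail (runs xs))
  runs-cover (x ∷ xs) (here refl) ¬pz with P? x
  ... | yes px = ⊥-elim (¬pz px)
  ... | no  _  = here (here refl)
  runs-cover (x ∷ xs) (there z∈) ¬pz with P? x | runs-cover xs z∈ ¬pz
  ... | yes _ | in-run         = there in-run
  ... | no  _ | here z∈first   = here (there z∈first)
  ... | no  _ | there in-later = there in-later

  -- Each cut point starts a new run.
  runs-count : ∀ xs → length (tail (runs xs)) ≤ length (filter P? xs)
  runs-count []       = z≤n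
  runs-count (x ∷ xs) with P? x
  ... | yes _ = s≤s (runs-count xs)
  ... | no  _ = runs-count xs

module Pigeonhole {A : Set} (_≟ᴬ_ : DecidableEquality A) where
  open DecMembership _≟ᴬ_ using (_∈?_)

  count : List A → List A → ℕ
  count C s = length (filter (_∈? s) C)

  count-cons : ∀ z C s → count C s ≤ count (z ∷ C) s
  count-cons z C s with z ∈? s
  ... | yes _ = n≤1+n _
  ... | no  _ = ≤-refl

  total-cons : ∀ z C (ss : List (List A)) → Any (z ∈_) ss →
               suc (sum (map (count C) ss)) ≤ sum (map (count (z ∷ C)) ss)
  total-cons z C (s ∷ ss) (here z∈s) rewrite filter-accept (_∈? s) {z} {C} z∈s =
    s≤s (+-monoʳ-≤ (count C s) (total-mono ss))
    where
    total-mono : ∀ ss → sum (map (count C) ss) ≤ sum (map (count (z ∷ C)) ss)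
    total-mono []       = z≤n
    total-mono (s ∷ ss) = +-mono-≤ (count-cons z C s) (total-mono ss)
  total-cons z C (s ∷ ss) (there z∈ss) =
    subst (_≤ count (z ∷ C) s + sum (map (count (z ∷ C)) ss)) (+-suc (count C s) _)
      (+-mono-≤ (count-cons z C s) (total-cons z C ss z∈ss))

  length-≤-total : ∀ C (ss : List (List A)) → All (λ z → Any (z ∈_) ss) C →
                   length C ≤ sum (map (count C) ss)
  length-≤-total []      ss _             = z≤n
  length-≤-total (z ∷ C) ss (z∈ss ∷ cov) =
    ≤-trans (s≤s (length-≤-total C ss cov)) (total-cons z C ss z∈ss)

  sum-≤-largest : (f : List A → ℕ) → ∀ s₀ ss →
                  ∃ λ s → s ∈ s₀ ∷ ss × sum (map f (s₀ ∷ ss)) ≤ suc (length ss) * f s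
  sum-≤-largest f s₀ [] = s₀ , here refl , ≤-refl
  sum-≤-largest f s₀ (s₁ ∷ ss) with sum-≤-largest f s₁ ss
  ... | s , s∈ , bound with ≤-total (f s₀) (f s)
  ...   | inj₁ f₀≤fs = s , there s∈ , +-mono-≤ f₀≤fs bound
  ...   | inj₂ fs≤f₀ = s₀ , here refl ,
          +-mono-≤ (≤-refl {f s₀}) (≤-trans bound (*-monoʳ-≤ (suc (length ss)) fs≤f₀))

  pigeonhole : ∀ C s₀ ss → All (λ z → Any (z ∈_) (s₀ ∷ ss)) C →
               ∃ λ s → s ∈ s₀ ∷ ss × length C ≤ suc (length ss) * count C s
  pigeonhole C s₀ ss cov with sum-≤-largest (count C) s₀ ss
  ... | s , s∈ , bound = s , s∈ , ≤-trans (length-≤-total C (s₀ ∷ ss) cov) bound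

-- Arc l Lo Hi: read cyclically, l has a contiguous arc S that contains no
-- Lo-element and outside of which (in X and Y) there is no Hi-element.
Arc : {A : Set} → List A → (A → Set) → (A → Set) → Set
Arc l Lo Hi = ∃₂ λ X S → ∃ λ Y →
  l ≡ X ++ S ++ Y × All (¬_ ∘ Lo) S × All (¬_ ∘ Hi) X × All (¬_ ∘ Hi) Y

arc-mono : ∀ {A : Set} {l : List A} {Lo Hi Lo′ Hi′ : A → Set} →
           (∀ {z} → Lo′ z → Lo z) → (∀ {z} → Hi′ z → Hi z) → Arc l Lo Hi → Arc l Lo′ Hi′
arc-mono lo hi (X , S , Y , l≡ , freeS , freeX , freeY) =
  X , S , Y , l≡ , All.map (_∘ lo) freeS , All.map (_∘ hi) freeX , All.map (_∘ hi) freeY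

block-arc : ∀ {A : Set} {Lo : A → Set} {l : List A} (X s Y : List A) {S : List A} →
            Unique l → l ≡ X ++ s ++ Y → All (¬_ ∘ Lo) s → (∀ {w} → w ∈ S → w ∈ s) →
            Arc l Lo (_∈ S)
block-arc X s Y u refl free S⊆s =
  X , s , Y , refl , free ,
  All.tabulate (λ z∈X z∈S → proj₁ (unique-middle X s Y u (S⊆s z∈S)) z∈X) ,
  All.tabulate (λ z∈Y z∈S → proj₂ (unique-middle X s Y u (S⊆s z∈S)) z∈Y)

-- The key observation: if a cyclic order l around f a has an arc avoiding
-- the images of the indices below a and containing those above a, then the
-- order induced on the indices is separated at a (the arc becomes τ, the
-- rest σ).
arc-separates : ∀ {t n} (f : Fin t → Fin n) (a : Fin t) {l : List (Fin n)} {Lo Hi : Fin n → Set} →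
                f a ∉ l → (∀ j → j < a → Lo (f j)) → (∀ j → a < j → Hi (f j)) →
                Arc l Lo Hi → SeparatedAt a (mapMaybe (preimage f) l)
arc-separates f a {l} {Lo} {Hi} fa∉l lo hi (X , S , Y , refl , freeS , freeX , freeY) =
  length (mX ++ mS) , mY ++ mX , mS , rotated , All-++⁺ below-Y below-X , above
  where
  g = preimage f
  mX = mapMaybe g X
  mS = mapMaybe g S
  mY = mapMaybe g Y

  rotated : rotate (length (mX ++ mS)) (mapMaybe g (X ++ S ++ Y)) ≡ (mY ++ mX) ++ mS
  rotated = begin
    rotate (length (mX ++ mS)) (mapMaybe g (X ++ S ++ Y))
      ≡⟨ cong (rotate (length (mX ++ mS))) (mapMaybe-++ g X (S ++ Y)) ⟩
    rotate (length (mX ++ mS)) (mX ++ mapMaybe g (S ++ Y))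
      ≡⟨ cong (λ r → rotate (length (mX ++ mS)) (mX ++ r)) (mapMaybe-++ g S Y) ⟩
    rotate (length (mX ++ mS)) (mX ++ mS ++ mY)
      ≡⟨ cong (rotate (length (mX ++ mS))) (sym (++-assoc mX mS mY)) ⟩
    rotate (length (mX ++ mS)) ((mX ++ mS) ++ mY)
      ≡⟨ rotate-++ (mX ++ mS) mY ⟩
    mY ++ mX ++ mS
      ≡⟨ sym (++-assoc mY mX mS) ⟩
    (mY ++ mX) ++ mS ∎
    where open ≡-Reasoning

  index-below : ∀ {z} → z ∈ l → ¬ Hi z → ∀ j → g z ≡ just j → j < a
  index-below z∈l ¬hi j gz≡j with preimage-sound f _ j gz≡j
  ... | refl with <-cmp j a
  ...   | tri< j<a _ _ = j<a
  ...   | tri≈ _ refl _ = ⊥-elim (fa∉l z∈l)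
  ...   | tri> _ _ a<j = ⊥-elim (¬hi (hi j a<j))

  index-above : ∀ {z} → z ∈ l → ¬ Lo z → ∀ j → g z ≡ just j → a < j
  index-above z∈l ¬lo j gz≡j with preimage-sound f _ j gz≡j
  ... | refl with <-cmp j a
  ...   | tri< j<a _ _ = ⊥-elim (¬lo (lo j j<a))
  ...   | tri≈ _ refl _ = ⊥-elim (fa∉l z∈l)
  ...   | tri> _ _ a<j = a<j

  below-X : All (_< a) mX
  below-X = mapMaybe-All g X (λ z∈ → index-below (∈-++⁺ˡ z∈) (All.lookup freeX z∈))
  below-Y : All (_< a) mY
  below-Y = mapMaybe-All g Y (λ z∈ → index-below (∈-++⁺ʳ X (∈-++⁺ʳ S z∈)) (All.lookup freeY z∈))
  above : All (a <_) mS
  above = mapMaybe-All g S (λ z∈ → index-above (∈-++⁺ʳ X (∈-++⁺ˡ z∈)) (All.lookup freeS z∈))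

-- Number of candidates that suffice to add r more elements to m chosen ones:
-- one candidate is chosen, and a (m + 1)-th of the others survives.
threshold : ℕ → ℕ → ℕ
threshold m zero    = 0
threshold m (suc r) = suc (suc m * threshold (suc m) r)

module Greedy {n : ℕ} (Π : RotationSystem n) where
  open DecMembership (_≟_ {n}) using (_∈?_)
  open Pigeonhole (_≟_ {n}) using (pigeonhole)

  Below Above : List (Fin n) → Fin n → Fin n → Set
  Below L y z = z ∈ L × z < y
  Above L y z = z ∈ L × y < z

  record Invariant (Ch C : List (Fin n)) : Set where
    field
      chosen-sorted     : AllPairs _<_ Ch
      candidates-sorted : AllPairs _<_ C
      chosen<candidate  : ∀ {z w} → z ∈ Ch → w ∈ C → z < w
      arcs              : ∀ {y} → y ∈ Ch →
                          Arc (rot Π y) (Below Ch y) (λ z → Above Ch y z ⊎ z ∈ C)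

  Complete : List (Fin n) → Set
  Complete L = AllPairs _<_ L × (∀ {y} → y ∈ L → Arc (rot Π y) (Below L y) (Above L y))

  initial : Invariant [] (allFin n)
  initial = record
    { chosen-sorted     = []
    ; candidates-sorted = AllPairsₚ.tabulate⁺-< id
    ; chosen<candidate  = λ ()
    ; arcs              = λ ()
    }

  choose : ∀ {Ch y C C′} → Invariant Ch (y ∷ C) → AllPairs _<_ C′ → (∀ {w} → w ∈ C′ → w ∈ C) →
           Arc (rot Π y) (_∈ Ch) (_∈ C′) → Invariant (Ch ++ [ y ]) C′
  choose {Ch} {y} {C} {C′} inv C′-sorted C′⊆C arc-y = record
    { chosen-sorted     = AllPairsₚ.++⁺ chosen-sorted ([] ∷ []) (All.tabulate (λ z∈ → chosen<candidate z∈ (here refl) ∷ []))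
    ; candidates-sorted = C′-sorted
    ; chosen<candidate  = λ z∈ w∈ → before-candidates z∈ (C′⊆C w∈)
    ; arcs              = arcs′
    }
    where
    open Invariant inv

    before-candidates : ∀ {z w} → z ∈ Ch ++ [ y ] → w ∈ C → z < w
    before-candidates z∈ w∈ with ∈-++⁻ Ch z∈
    ... | inj₁ z∈Ch        = chosen<candidate z∈Ch (there w∈)
    ... | inj₂ (here refl) = All.lookup (AllPairs.head candidates-sorted) w∈

    arcs′ : ∀ {x} → x ∈ Ch ++ [ y ] →
            Arc (rot Π x) (Below (Ch ++ [ y ]) x) (λ z → Above (Ch ++ [ y ]) x z ⊎ z ∈ C′)
    arcs′ {x} x∈ with ∈-++⁻ Ch x∈
    ... | inj₁ x∈Ch = arc-mono lo hi (arcs x∈Ch)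
      where
      -- y is a candidate for the earlier chosen x
      lo : ∀ {z} → Below (Ch ++ [ y ]) x z → Below Ch x z
      lo (z∈ , z<x) with ∈-++⁻ Ch z∈
      ... | inj₁ z∈Ch        = z∈Ch , z<x
      ... | inj₂ (here refl) = ⊥-elim (<-asym z<x (chosen<candidate x∈Ch (here refl)))
      hi : ∀ {z} → Above (Ch ++ [ y ]) x z ⊎ z ∈ C′ → Above Ch x z ⊎ z ∈ y ∷ C
      hi (inj₁ (z∈ , x<z)) with ∈-++⁻ Ch z∈
      ... | inj₁ z∈Ch        = inj₁ (z∈Ch , x<z)
      ... | inj₂ (here refl) = inj₂ (here refl)
      hi (inj₂ z∈C′) = inj₂ (there (C′⊆C z∈C′))
    ... | inj₂ (here refl) = arc-mono lo hi arc-y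
      where
      -- y is the largest chosen element
      lo : ∀ {z} → Below (Ch ++ [ y ]) y z → z ∈ Ch
      lo (z∈ , z<y) with ∈-++⁻ Ch z∈
      ... | inj₁ z∈Ch        = z∈Ch
      ... | inj₂ (here refl) = ⊥-elim (<-irrefl refl z<y)
      hi : ∀ {z} → Above (Ch ++ [ y ]) y z ⊎ z ∈ C′ → z ∈ C′
      hi (inj₁ (z∈ , y<z)) with ∈-++⁻ Ch z∈
      ... | inj₁ z∈Ch        = ⊥-elim (<-asym y<z (chosen<candidate z∈Ch (here refl)))
      ... | inj₂ (here refl) = ⊥-elim (<-irrefl refl y<z)
      hi (inj₂ z∈C′) = z∈C′

  step : ∀ {Ch y C} → Invariant Ch (y ∷ C) →
         ∃ λ C′ → Invariant (Ch ++ [ y ]) C′ × length C ≤ suc (length Ch) * length C′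
  step {Ch} {y} {C} inv = keep (pigeonhole C (head (runs l)) (tail (runs l)) covered)
    where
    open Invariant inv
    open Runs (_∈? Ch)
    l = rot Π y
    l-unique : Unique l
    l-unique = proj₂ (proj₂ (valid Π y))

    -- every remaining candidate occurs in Π(y) and is not chosen
    covered : All (λ z → Any (z ∈_) (head (runs l) ∷ tail (runs l))) C
    covered = All.tabulate λ {z} z∈C →
      runs-cover l (proj₁ (valid Π y) z (λ z≡y → <-irrefl (sym z≡y) (All.lookup (AllPairs.head candidates-sorted) z∈C)))
                   (λ z∈Ch → <-irrefl refl (chosen<candidate z∈Ch (there z∈C)))

    -- there are at most |Ch| + 1 runs, as Π(y) lists each chosen element once
    few-runs : length (tail (runs l)) ≤ length Ch
    few-runs = ≤-trans (runs-count l)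
      (unique-length-≤ Ch (Unique.filter⁺ (_∈? Ch) l-unique) (all-filter (_∈? Ch) l))

    keep : (∃ λ s → s ∈ head (runs l) ∷ tail (runs l) ×
                    length C ≤ suc (length (tail (runs l))) * length (filter (_∈? s) C)) →
           ∃ λ C′ → Invariant (Ch ++ [ y ]) C′ × length C ≤ suc (length Ch) * length C′
    keep (s , s∈ , many) with All.lookup (runs-are-runs l) s∈
    ... | free , X , Y , l≡ =
      filter (_∈? s) C ,
      choose inv (AllPairsₚ.filter⁺ (_∈? s) (AllPairs.tail candidates-sorted)) (proj₁ ∘ ∈-filter⁻ (_∈? s) {xs = C})
        (block-arc X s Y l-unique l≡ free (proj₂ ∘ ∈-filter⁻ (_∈? s) {xs = C})) ,
      ≤-trans many (*-monoˡ-≤ _ (s≤s few-runs))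

  extend : ∀ r {Ch C} → Invariant Ch C → threshold (length Ch) r ≤ length C →
           ∃ λ L → length L ≡ length Ch + r × Complete L
  extend zero {Ch} inv _ =
    Ch , sym (+-identityʳ _) , chosen-sorted , λ y∈ → arc-mono id inj₁ (arcs y∈)
    where open Invariant inv
  extend (suc r) {Ch} {y ∷ C} inv (s≤s enough) =
    let C′ , inv′ , shrink = step inv
        L , |L| , complete = extend r inv′ (still-enough C′ shrink)
    in L , trans |L| length-snoc+r , complete
    where
    m = length Ch
    -- |Ch ++ [ y ]| = m + 1, and (m + 1)·threshold (m + 1) r ≤ |C| ≤ (m + 1)·|C′|
    still-enough : ∀ C′ → length C ≤ suc m * length C′ → threshold (length (Ch ++ [ y ])) r ≤ length C′
    still-enough C′ shrink rewrite length-++ Ch {[ y ]} | +-comm m 1 =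
      *-cancelˡ-≤ (suc m) (≤-trans enough shrink)
    length-snoc+r : length (Ch ++ [ y ]) + r ≡ m + suc r
    length-snoc+r = trans (cong (_+ r) (length-++ Ch)) (+-assoc m 1 r)

  separated-subsystem : ∀ {t} (L : List (Fin n)) → length L ≡ t → Complete L →
                        ∃[ f ] (StrictlyIncreasing {t} {n} f × Separated (induced Π f))
  separated-subsystem L refl (sorted , arcs) =
      lookup L
    , (λ _ _ → lookup-mono sorted)
    , λ a → arc-separates (lookup L) a (proj₁ (proj₂ (valid Π (lookup L a))))
              (λ j j<a → ∈-lookup j , lookup-mono sorted j<a)
              (λ j a<j → ∈-lookup j , lookup-mono sorted a<j)
              (arcs (∈-lookup a))

claim1 : (t : ℕ) → 1 ≤ t → ∃[ n₁ ] ((n : ℕ) → n₁ ≤ n → (Π : RotationSystem n) → ∃[ f ] (StrictlyIncreasing {t} {n} f × Separated (induced Π f)))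
claim1 t _ = threshold 0 t , λ n n₁≤n Π →
  let open Greedy Π
      enough : threshold (length {A = Fin n} []) t ≤ length (allFin n)
      enough = subst (threshold 0 t ≤_) (sym (length-tabulate id)) n₁≤n
      L , |L|≡t , complete = extend t initial enough
  in separated-subsystem L |L|≡t complete
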